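{- Let $P\colon\mathcal{C}^{op}\to\mathbf{DLat}$ be a $\{\land,\lor\}$-doctrine with existential completion $P^\exists$ as described in the context. For each $c\in\mathcal{C}$, the homomorphism $\eta_c\colon P(c)\to P^\exists(c)$, $x\mapsto\{(1,x)\}$, is injective.
   Context: A $\{\land,\lor\}$-doctrine is a functor $P\colon\mathcal{C}^{op}\to\mathbf{DLat}$ ($\mathcal{C}$ with finite products, $1$ terminal); $f^\ast=P(f)$; $\pi_d\colon d\times c\to c$ is the projection forgetting $d$. $P^\exists(c)$ is the posetal reflection of the preorder of finite sets $\{(d_1,x_1),\dots,(d_n,x_n)\}$ ($d_i\in\mathcal{C}$, $x_i\in P(d_i\times c)$) with $\{(d_i,x_i)\}_{i\le n}\le\{(e_j,y_j)\}_{j\le m}$ iff for each $i$ there are arrows $r_\ell\colon d_i\times c\to e_{j_\ell}\times c$ ($\ell=1,\dots,k$, $j_\ell\le m$) with $\pi_{e_{j_\ell}}\circ r_\ell=\pi_{d_i}$ and $x_i\le r_1^\ast y_{j_1}\lor\dots\lor r_k^\ast y_{j_k}$. In $\{(1,x)\}$ one identifies $1\times c\cong c$. -}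

module Defs where

open import Level using (Level; _⊔_) renaming (suc to lsuc)
open import Relation.Binary.PropositionalEquality using (_≡_)
open import Algebra.Lattice.Bundles using (DistributiveLattice)
open import Data.List using (List; []; _∷_; foldr)
open import Data.List.Membership.Propositional using (_∈_)
open import Data.Product using (Σ; _×_; _,_; ∃; ∃-syntax)

record CartesianCategory (o h : Level) : Set (lsuc (o ⊔ h)) where
  infixr 9 _∘_
  field
    Obj  : Set o
    Hom  : Obj → Obj → Set h
    id   : ∀ {a} → Hom a a
    _∘_  : ∀ {a b c} → Hom b c → Hom a b → Hom a c
    idˡ  : ∀ {a b} (f : Hom a b) → id ∘ f ≡ f
    idʳ  : ∀ {a b} (f : Hom a b) → f ∘ id ≡ f
    assoc : ∀ {a b c d} (f : Hom c d) (g : Hom b c) (k : Hom a b) →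
            (f ∘ g) ∘ k ≡ f ∘ (g ∘ k)
    𝟙    : Obj
    !    : ∀ {a} → Hom a 𝟙
    !-unique : ∀ {a} (f : Hom a 𝟙) → f ≡ !
    _⊗_  : Obj → Obj → Obj
    fst  : ∀ {a b} → Hom (a ⊗ b) a
    snd  : ∀ {a b} → Hom (a ⊗ b) b
    ⟨_,_⟩ : ∀ {x a b} → Hom x a → Hom x b → Hom x (a ⊗ b)
    fst-β : ∀ {x a b} (f : Hom x a) (g : Hom x b) → fst ∘ ⟨ f , g ⟩ ≡ f
    snd-β : ∀ {x a b} (f : Hom x a) (g : Hom x b) → snd ∘ ⟨ f , g ⟩ ≡ g
    ⟨⟩-unique : ∀ {x a b} (h : Hom x (a ⊗ b)) → ⟨ fst ∘ h , snd ∘ h ⟩ ≡ h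

record BoundedDistributiveLattice (c ℓ : Level) : Set (lsuc (c ⊔ ℓ)) where
  field
    distributiveLattice : DistributiveLattice c ℓ
  open DistributiveLattice distributiveLattice public
  field
    ⊥ ⊤ : Carrier
    ∨-identityˡ : ∀ x → (⊥ ∨ x) ≈ x
    ∧-identityˡ : ∀ x → (⊤ ∧ x) ≈ x

  _≤_ : Carrier → Carrier → Set ℓ
  x ≤ y = x ≈ (x ∧ y)

record Doctrine {o h : Level} (C : CartesianCategory o h) (c ℓ : Level)
       : Set (lsuc (o ⊔ h ⊔ c ⊔ ℓ)) where
  open CartesianCategory C
  field
    P    : Obj → BoundedDistributiveLattice c ℓ
  open BoundedDistributiveLattice
  field
    _^*  : ∀ {a b} → Hom a b → Carrier (P b) → Carrier (P a)
    ^*-cong : ∀ {a b} (f : Hom a b) {x y} → _≈_ (P b) x y →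
              _≈_ (P a) ((f ^*) x) ((f ^*) y)
    ^*-∧ : ∀ {a b} (f : Hom a b) x y →
           _≈_ (P a) ((f ^*) (_∧_ (P b) x y)) (_∧_ (P a) ((f ^*) x) ((f ^*) y))
    ^*-∨ : ∀ {a b} (f : Hom a b) x y →
           _≈_ (P a) ((f ^*) (_∨_ (P b) x y)) (_∨_ (P a) ((f ^*) x) ((f ^*) y))
    ^*-⊥ : ∀ {a b} (f : Hom a b) → _≈_ (P a) ((f ^*) (⊥ (P b))) (⊥ (P a))
    ^*-⊤ : ∀ {a b} (f : Hom a b) → _≈_ (P a) ((f ^*) (⊤ (P b))) (⊤ (P a))
    ^*-id : ∀ {a} x → _≈_ (P a) ((id ^*) x) x
    ^*-∘ : ∀ {a b d} (g : Hom b d) (f : Hom a b) x →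
           _≈_ (P a) (((g ∘ f) ^*) x) ((f ^*) ((g ^*) x))

module ExistentialCompletion {o h c ℓ : Level} {C : CartesianCategory o h}
       (D : Doctrine C c ℓ) where
  open CartesianCategory C
  open Doctrine D
  open BoundedDistributiveLattice

  Pair : Obj → Set (o ⊔ c)
  Pair a = Σ Obj (λ d → Carrier (P (d ⊗ a)))

  -- finite sets of pairs, presented as lists
  PreEx : Obj → Set (o ⊔ c)
  PreEx a = List (Pair a)

  record Witness {a : Obj} (d : Obj) (ys : PreEx a) : Set (o ⊔ h ⊔ c) where
    constructor witness
    field
      e   : Obj
      y   : Carrier (P (e ⊗ a))
      mem : (e , y) ∈ ys
      r   : Hom (d ⊗ a) (e ⊗ a)
      over : snd ∘ r ≡ snd

  joinW : ∀ {a d} {ys : PreEx a} → List (Witness d ys) → Carrier (P (d ⊗ a))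
  joinW {a} {d} [] = ⊥ (P (d ⊗ a))
  joinW {a} {d} (w ∷ ws) =
    _∨_ (P (d ⊗ a)) ((Witness.r w ^*) (Witness.y w)) (joinW ws)

  _≼_ : ∀ {a} → PreEx a → PreEx a → Set (o ⊔ h ⊔ c ⊔ ℓ)
  _≼_ {a} xs ys = ∀ {d x} → (d , x) ∈ xs →
    ∃[ ws ] _≤_ (P (d ⊗ a)) x (joinW {a} {d} {ys} ws)

  -- equality in the posetal reflection P^∃(a)
  _≃_ : ∀ {a} → PreEx a → PreEx a → Set (o ⊔ h ⊔ c ⊔ ℓ)
  xs ≃ ys = (xs ≼ ys) × (ys ≼ xs)

  -- η_a : P(a) → P^∃(a),  x ↦ {(1, x)}, using 1 × a ≅ a (via π_1 = snd)
  η : ∀ {a} → Carrier (P a) → PreEx a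
  η x = (𝟙 , (snd ^*) x) ∷ []

-- A witness for  η x ≼ η y  consists of arrows r : 1 × a → 1 × a over a, and
-- reindexing along such an r fixes  π* y ; so the witness just says
-- π* x ≤ π* y  for the projection  π : 1 × a → a.  Since π has the section
-- ⟨ ! , id ⟩, π* reflects the order, whence x ≤ y; antisymmetry finishes.
{-# OPTIONS --safe #-}
module Submission where

open import Defs
open import Level using (Level)
open import Algebra.Lattice.Bundles using (DistributiveLattice)
open import Relation.Binary.PropositionalEquality using (_≡_; refl; cong)
open import Data.List using (List; []; _∷_)
open import Data.List.Relation.Unary.Any using (here; there)
open import Data.Product using (_,_)
import Algebra.Lattice.Properties.Lattice as LatticeProperties
import Relation.Binary.Lattice as OrderTheoretic
import Relation.Binary.Reasoning.Setoid as SetoidReasoning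
import Relation.Binary.Reasoning.PartialOrder as PartialOrderReasoning

module BoundedDistributiveLatticeProperties {c ℓ : Level}
       (L : BoundedDistributiveLattice c ℓ) where
  open BoundedDistributiveLattice L
  open LatticeProperties (DistributiveLattice.lattice distributiveLattice)
    using (∨-∧-orderTheoreticLattice)
  open OrderTheoretic.Lattice ∨-∧-orderTheoreticLattice public
    using (∨-least; antisym; poset)
    renaming (trans to ≤-trans; reflexive to ≤-reflexive)

  module ≤-Reasoning = PartialOrderReasoning poset

  ⊥-minimum : ∀ z → ⊥ ≤ z
  ⊥-minimum z = begin
    ⊥           ≈⟨ ∧-absorbs-∨ ⊥ z ⟨
    ⊥ ∧ (⊥ ∨ z) ≈⟨ ∧-congˡ (∨-identityˡ z) ⟩
    ⊥ ∧ z       ∎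
    where open SetoidReasoning setoid

module DoctrineProperties {o h c ℓ : Level} {C : CartesianCategory o h}
       (D : Doctrine C c ℓ) where
  open CartesianCategory C
  open Doctrine D
  open ExistentialCompletion D
  open BoundedDistributiveLattice using (Carrier; _≈_; _≤_; trans; setoid)
  module L {b : Obj} = BoundedDistributiveLatticeProperties (P b)

  ^*-mono : ∀ {a b} (f : Hom a b) {x y} →
            _≤_ (P b) x y → _≤_ (P a) ((f ^*) x) ((f ^*) y)
  ^*-mono {a} f {x} {y} x≤y = trans (P a) (^*-cong f x≤y) (^*-∧ f x y)

  ^*-resp-∘ : ∀ {a b d} {g : Hom b d} {f : Hom a b} {k : Hom a d} →
              g ∘ f ≡ k → ∀ z → _≈_ (P a) ((f ^*) ((g ^*) z)) ((k ^*) z)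
  ^*-resp-∘ {a} {g = g} {f} {k} g∘f≡k z = begin
    (f ^*) ((g ^*) z) ≈⟨ ^*-∘ g f z ⟨
    ((g ∘ f) ^*) z    ≡⟨ cong (λ u → (u ^*) z) g∘f≡k ⟩
    (k ^*) z          ∎
    where open SetoidReasoning (setoid (P a))

  ^*-reflects-≤ : ∀ {a b} {g : Hom b a} {s : Hom a b} → g ∘ s ≡ id → ∀ {x y} →
                  _≤_ (P b) ((g ^*) x) ((g ^*) y) → _≤_ (P a) x y
  ^*-reflects-≤ {a} {g = g} {s} g∘s≡id {x} {y} g*x≤g*y = begin
    x                 ≈⟨ s*g*≈id x ⟨
    (s ^*) ((g ^*) x) ≤⟨ ^*-mono s g*x≤g*y ⟩
    (s ^*) ((g ^*) y) ≈⟨ s*g*≈id y ⟩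
    y                 ∎
    where
      open L.≤-Reasoning
      s*g*≈id : ∀ z → _≈_ (P a) ((s ^*) ((g ^*) z)) z
      s*g*≈id z = trans (P a) (^*-resp-∘ g∘s≡id z) (^*-id z)

  joinW-least : ∀ {a d} {ys : PreEx a} {z : Carrier (P (d ⊗ a))} →
                (∀ (w : Witness d ys) →
                   _≤_ (P (d ⊗ a)) ((Witness.r w ^*) (Witness.y w)) z) →
                ∀ ws → _≤_ (P (d ⊗ a)) (joinW ws) z
  joinW-least bound []       = L.⊥-minimum _
  joinW-least bound (w ∷ ws) = L.∨-least (bound w) (joinW-least bound ws)

  η-witness-≤ : ∀ {a d} {y : Carrier (P a)} (w : Witness d (η y)) →
                _≤_ (P (d ⊗ a)) ((Witness.r w ^*) (Witness.y w)) ((snd ^*) y)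
  η-witness-≤ (witness _ _ (here refl) r over) = L.≤-reflexive (^*-resp-∘ over _)
  η-witness-≤ (witness _ _ (there ()) _ _)

  η-reflects-≤ : ∀ {a} {x y : Carrier (P a)} → η x ≼ η y → _≤_ (P a) x y
  η-reflects-≤ η-x≼η-y with η-x≼η-y (here refl)
  ... | ws , π*x≤joinW =
    ^*-reflects-≤ (snd-β ! id) (L.≤-trans π*x≤joinW (joinW-least η-witness-≤ ws))

lemma4p7 : ∀ {o h c ℓ} {C : CartesianCategory o h} (D : Doctrine C c ℓ) →
    let open CartesianCategory C
        open Doctrine D
        open ExistentialCompletion D
    in ∀ (a : Obj) (x y : BoundedDistributiveLattice.Carrier (P a)) →
    η {a} x ≃ η {a} y → BoundedDistributiveLattice._≈_ (P a) x y
lemma4p7 D a x y (η-x≼η-y , η-y≼η-x) =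
  L.antisym (η-reflects-≤ η-x≼η-y) (η-reflects-≤ η-y≼η-x)
  where open DoctrineProperties D
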